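{- Let $G$ be a finite nonabelian simple group, $x\in G$ an involution and $\alpha=\sigma_x$ (so $\alpha(y)=xyx$). For $i=1,2$ let $a_i\in G$ be such that $S_i=\{a_i,\alpha(a_i^{ -1})\}$ is a generalized Cayley subset with respect to $\alpha$, and let $X_i=\mathrm{GC}(G,S_i,\alpha)$. If there exists $\delta\in\Delta_\alpha$ with $\delta(xa_1)=xa_2$, then $X_1\cong X_2$.
   Context: $\sigma_h$ is conjugation $y\mapsto hyh^{ -1}$. $\mathrm{Aut}(G)_\alpha=\{\gamma\in\mathrm{Aut}(G):\gamma\alpha=\alpha\gamma\}$ and $\Delta_\alpha=\mathrm{Inn}(G)\,\mathrm{Aut}(G)_\alpha\le \mathrm{Aut}(G)$. Generalized Cayley subsets and graphs: for $\alpha\in\mathrm{Aut}(G)$ with $\alpha^2=1$, $S\subseteq G$ is a generalized Cayley subset w.r.t. $\alpha$ if $\alpha(g)g^{ -1}\notin S$ for all $g\in G$ and $\alpha(g^{ -1})h\in S$ implies $\alpha(h^{ -1})g\in S$; then $\mathrm{GC}(G,S,\alpha)$ is the simple undirected graph on vertex set $G$ with $\{g,h\}$ an edge iff $\alpha(g^{ -1})h\in S$. -}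

module Defs where

open import Level using (Level; _⊔_)
open import Data.Nat using (ℕ)
open import Data.Fin using (Fin)
open import Data.Product using (Σ; ∃; ∃-syntax; _×_; _,_)
open import Data.Sum using (_⊎_)
open import Relation.Nullary using (¬_)
open import Function.Bundles using (Func; Bijection)
open import Algebra.Bundles using (Group)
open import Algebra.Morphism.Structures using (module GroupMorphisms)

module _ {c ℓ : Level} (G : Group c ℓ) where
  open Group G

  IsFiniteGroup : Set (c ⊔ ℓ)
  IsFiniteGroup = ∃[ n ] Σ (Fin n → Carrier) (λ f → ∀ g → ∃[ i ] f i ≈ g)

  IsNonabelian : Set (c ⊔ ℓ)
  IsNonabelian = ¬ (∀ g h → g ∙ h ≈ h ∙ g)

  record IsNormalSubgroup (N : Carrier → Set (c ⊔ ℓ)) : Set (c ⊔ ℓ) where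
    field
      resp   : ∀ {g h} → g ≈ h → N g → N h
      has-ε  : N ε
      ∙-closed : ∀ {g h} → N g → N h → N (g ∙ h)
      ⁻¹-closed : ∀ {g} → N g → N (g ⁻¹)
      conj-closed : ∀ {g} h → N g → N (h ∙ g ∙ h ⁻¹)

  IsSimple : Set (Level.suc (c ⊔ ℓ))
  IsSimple = (∃[ g ] ¬ (g ≈ ε))
           × (∀ N → IsNormalSubgroup N → (∀ g → N g → g ≈ ε) ⊎ (∀ g → N g))

  IsAutomorphism : (Carrier → Carrier) → Set (c ⊔ ℓ)
  IsAutomorphism f = GroupMorphisms.IsGroupIsomorphism rawGroup rawGroup f

  σ : Carrier → Carrier → Carrier
  σ h y = h ∙ y ∙ h ⁻¹

  IsInvolution : Carrier → Set ℓ
  IsInvolution x = ¬ (x ≈ ε) × (x ∙ x ≈ ε)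

  InCentralizer : (α γ : Carrier → Carrier) → Set (c ⊔ ℓ)
  InCentralizer α γ = IsAutomorphism γ × (∀ y → γ (α y) ≈ α (γ y))

  InΔ : (α δ : Carrier → Carrier) → Set (c ⊔ ℓ)
  InΔ α δ = IsAutomorphism δ
          × ∃[ h ] Σ (Carrier → Carrier) (λ γ → InCentralizer α γ × (∀ y → δ y ≈ σ h (γ y)))

  IsGenCayleySubset : (α : Carrier → Carrier) (S : Carrier → Set ℓ) → Set (c ⊔ ℓ)
  IsGenCayleySubset α S =
      (∀ g → ¬ S (α g ∙ g ⁻¹))
    × (∀ g h → S (α (g ⁻¹) ∙ h) → S (α (h ⁻¹) ∙ g))

  Pair : (α : Carrier → Carrier) (a : Carrier) → Carrier → Set ℓ
  Pair α a y = (y ≈ a) ⊎ (y ≈ α (a ⁻¹))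

  GCAdj : (α : Carrier → Carrier) (S : Carrier → Set ℓ) → Carrier → Carrier → Set ℓ
  GCAdj α S g h = S (α (g ⁻¹) ∙ h)

  GraphIso : (E₁ E₂ : Carrier → Carrier → Set ℓ) → Set (c ⊔ ℓ)
  GraphIso E₁ E₂ = Σ (Bijection setoid setoid) λ φ →
    ∀ g h → (E₁ g h → E₂ (Bijection.to φ g) (Bijection.to φ h))
          × (E₂ (Bijection.to φ g) (Bijection.to φ h) → E₁ g h)

module Submission where

-- Idea of the proof.  Write α = σ_x and let δ = σ_k ∘ γ ∈ Δ_α with γ ∈ Aut(G)_α.
--
-- (1) A nonabelian simple group has trivial centre, because the centre is a
--     normal subgroup.  In such a group an element is determined by the inner
--     automorphism it induces.
-- (2) Since γ σ_x γ⁻¹ = σ_{γ(x)} and γ commutes with σ_x, we get σ_{γ(x)} = σ_x,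
--     hence γ(x) = x and δ(x) = k x k⁻¹.
-- (3) For any automorphism δ with δ(x) = k x k⁻¹ the "twisted translation"
--     φ(g) = k⁻¹ δ(g) is a bijection of G satisfying
--        α(φ(g)⁻¹) φ(h) = M(α(g⁻¹) h),   where M(z) = x δ(x⁻¹ z),
--     so φ turns the connection set S₁ into M(S₁).
-- (4) If x is an involution and δ(x a₁) = x a₂, then M sends a₁ ↦ a₂ and
--     α(a₁⁻¹) ↦ α(a₂⁻¹), i.e. M maps S₁ = {a₁, α(a₁⁻¹)} onto S₂.
-- (5) A bijection satisfying the identity of (3) for a map M carrying S₁ onto
--     S₂ is a graph isomorphism GC(G,S₁,α) ≅ GC(G,S₂,α).

open import Defs
open import Level using (Level; _⊔_)
open import Data.Product using (_×_; ∃-syntax; _,_; proj₁; proj₂)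
open import Data.Sum using (inj₁; inj₂)
open import Data.Empty using (⊥-elim)
open import Algebra.Bundles using (Group)
open import Algebra.Morphism.Structures using (module GroupMorphisms)
open import Function.Bundles using (Bijection; _⇔_; mk⇔; Equivalence)

module _ {c ℓ : Level} (G : Group c ℓ) where
  open Group G
  open import Algebra.Properties.Group G
  open import Algebra.Solver.Monoid monoid using (solve; _⊜_; _⊕_)
  open import Relation.Binary.Reasoning.Setoid setoid

  Central : Carrier → Set (c ⊔ ℓ)
  Central g = ∀ w → g ∙ w ≈ w ∙ g

  central-conj-fixed : ∀ {g} h → Central g → σ G h g ≈ g
  central-conj-fixed {g} h g-central = begin
    h ∙ g ∙ h ⁻¹ ≈⟨ ∙-congʳ (sym (g-central h)) ⟩
    g ∙ h ∙ h ⁻¹ ≈⟨ //-rightDividesʳ h g ⟩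
    g            ∎

  centre-normal : IsNormalSubgroup G Central
  centre-normal = record
    { resp = λ {g} {h} g≈h g-central w → begin
        h ∙ w ≈⟨ ∙-congʳ (sym g≈h) ⟩
        g ∙ w ≈⟨ g-central w ⟩
        w ∙ g ≈⟨ ∙-congˡ g≈h ⟩
        w ∙ h ∎
    ; has-ε = λ w → trans (identityˡ w) (sym (identityʳ w))
    ; ∙-closed = λ {g} {h} g-central h-central w → begin
        g ∙ h ∙ w   ≈⟨ assoc g h w ⟩
        g ∙ (h ∙ w) ≈⟨ ∙-congˡ (h-central w) ⟩
        g ∙ (w ∙ h) ≈⟨ sym (assoc g w h) ⟩
        g ∙ w ∙ h   ≈⟨ ∙-congʳ (g-central w) ⟩
        w ∙ g ∙ h   ≈⟨ assoc w g h ⟩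
        w ∙ (g ∙ h) ∎
    ; ⁻¹-closed = λ {g} g-central w → ∙-cancelˡ g (g ⁻¹ ∙ w) (w ∙ g ⁻¹) (begin
        g ∙ (g ⁻¹ ∙ w)   ≈⟨ \\-leftDividesˡ g w ⟩
        w                ≈⟨ sym (//-rightDividesʳ g w) ⟩
        w ∙ g ∙ g ⁻¹     ≈⟨ ∙-congʳ (sym (g-central w)) ⟩
        g ∙ w ∙ g ⁻¹     ≈⟨ assoc g w (g ⁻¹) ⟩
        g ∙ (w ∙ g ⁻¹)   ∎)
    ; conj-closed = λ h g-central w → begin
        σ G h _ ∙ w ≈⟨ ∙-congʳ (central-conj-fixed h g-central) ⟩
        _ ∙ w       ≈⟨ g-central w ⟩
        w ∙ _       ≈⟨ ∙-congˡ (sym (central-conj-fixed h g-central)) ⟩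
        w ∙ σ G h _ ∎
    }

  TrivialCentre : Set (c ⊔ ℓ)
  TrivialCentre = ∀ g → Central g → g ≈ ε

  centre-trivial : IsNonabelian G → IsSimple G → TrivialCentre
  centre-trivial nonabelian (_ , simple) with simple Central centre-normal
  ... | inj₁ trivial = trivial
  ... | inj₂ everything = ⊥-elim (nonabelian everything)

  same-conj⇒central : ∀ p q → (∀ w → σ G p w ≈ σ G q w) → Central (q ⁻¹ ∙ p)
  same-conj⇒central p q same w = begin
    q ⁻¹ ∙ p ∙ w                 ≈⟨ assoc (q ⁻¹) p w ⟩
    q ⁻¹ ∙ (p ∙ w)               ≈⟨ ∙-congˡ (sym (//-rightDividesˡ p (p ∙ w))) ⟩
    q ⁻¹ ∙ (σ G p w ∙ p)         ≈⟨ ∙-congˡ (∙-congʳ (same w)) ⟩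
    q ⁻¹ ∙ (q ∙ w ∙ q ⁻¹ ∙ p)    ≈⟨ solve 5 (λ q' q w q'' p → q' ⊕ (((q ⊕ w) ⊕ q'') ⊕ p)
                                              ⊜ q' ⊕ (q ⊕ (w ⊕ (q'' ⊕ p))))
                                            refl (q ⁻¹) q w (q ⁻¹) p ⟩
    q ⁻¹ ∙ (q ∙ (w ∙ (q ⁻¹ ∙ p))) ≈⟨ \\-leftDividesʳ q (w ∙ (q ⁻¹ ∙ p)) ⟩
    w ∙ (q ⁻¹ ∙ p)               ∎

  same-conj⇒≈ : TrivialCentre → ∀ p q → (∀ w → σ G p w ≈ σ G q w) → p ≈ q
  same-conj⇒≈ trivial p q same =
    sym (⁻¹-injective (inverseˡ-unique (q ⁻¹) p
      (trivial (q ⁻¹ ∙ p) (same-conj⇒central p q same))))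

  auto-conj : ∀ {γ} → IsAutomorphism G γ → ∀ p y → γ (σ G p y) ≈ σ G (γ p) (γ y)
  auto-conj {γ} γ-auto p y = begin
    γ (p ∙ y ∙ p ⁻¹)       ≈⟨ ∙-homo (p ∙ y) (p ⁻¹) ⟩
    γ (p ∙ y) ∙ γ (p ⁻¹)   ≈⟨ ∙-cong (∙-homo p y) (⁻¹-homo p) ⟩
    γ p ∙ γ y ∙ γ p ⁻¹     ∎
    where open GroupMorphisms.IsGroupIsomorphism γ-auto

  centraliser-fixes : TrivialCentre → ∀ {x γ} → InCentralizer G (σ G x) γ → γ x ≈ x
  centraliser-fixes trivial {x} {γ} (γ-auto , γ-comm) =
    same-conj⇒≈ trivial (γ x) x λ w →
      let (y , γy≈w) = surjective w in begin
        σ G (γ x) w     ≈⟨ ∙-congʳ (∙-congˡ (sym (γy≈w refl))) ⟩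
        σ G (γ x) (γ y) ≈⟨ sym (auto-conj γ-auto x y) ⟩
        γ (σ G x y)     ≈⟨ γ-comm y ⟩
        σ G x (γ y)     ≈⟨ ∙-congʳ (∙-congˡ (γy≈w refl)) ⟩
        σ G x w         ∎
    where open GroupMorphisms.IsGroupIsomorphism γ-auto

  Δ-conjugates : TrivialCentre → ∀ {x δ} → InΔ G (σ G x) δ → ∃[ k ] δ x ≈ σ G k x
  Δ-conjugates trivial {x} {δ} (_ , k , γ , γ∈Aut-α , δ≈σ∘γ) =
    k , trans (δ≈σ∘γ x) (∙-congʳ (∙-congˡ (centraliser-fixes trivial γ∈Aut-α)))

  conj-⁻¹ : ∀ p y → σ G p y ⁻¹ ≈ σ G p (y ⁻¹)
  conj-⁻¹ p y = begin
    (p ∙ y ∙ p ⁻¹) ⁻¹        ≈⟨ ⁻¹-anti-homo-∙ (p ∙ y) (p ⁻¹) ⟩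
    p ⁻¹ ⁻¹ ∙ (p ∙ y) ⁻¹     ≈⟨ ∙-cong (⁻¹-involutive p) (⁻¹-anti-homo-∙ p y) ⟩
    p ∙ (y ⁻¹ ∙ p ⁻¹)        ≈⟨ sym (assoc p (y ⁻¹) (p ⁻¹)) ⟩
    p ∙ y ⁻¹ ∙ p ⁻¹          ∎

  -- Twisted translations: for an automorphism δ with δ(x) = σ_k(x), the map
  -- φ(g) = k⁻¹ δ(g) intertwines the adjacency of GC(G,-,σ_x) with the map
  -- M(z) = x δ(x⁻¹ z) on connection sets.
  module TwistedTranslation (x : Carrier) {δ : Carrier → Carrier}
                            (δ-auto : IsAutomorphism G δ)
                            (k : Carrier) (δx : δ x ≈ σ G k x) where
    open GroupMorphisms.IsGroupIsomorphism δ-auto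

    φ : Carrier → Carrier
    φ g = k ⁻¹ ∙ δ g

    φ-bijection : Bijection setoid setoid
    φ-bijection = record
      { to = φ
      ; cong = λ g≈h → ∙-congˡ (⟦⟧-cong g≈h)
      ; bijective = (λ {g} {h} φg≈φh → injective (∙-cancelˡ (k ⁻¹) (δ g) (δ h) φg≈φh))
                  , λ y → let (g , δg≈ky) = surjective (k ∙ y) in
                      g , λ z≈g → trans (∙-congˡ (δg≈ky z≈g)) (\\-leftDividesʳ k y)
      }

    M : Carrier → Carrier
    M z = x ∙ δ (x ⁻¹ ∙ z)

    M-cong : ∀ {z z′} → z ≈ z′ → M z ≈ M z′
    M-cong z≈z′ = ∙-congˡ (⟦⟧-cong (∙-congˡ z≈z′))

    M-injective : ∀ {z z′} → M z ≈ M z′ → z ≈ z′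
    M-injective {z} {z′} Mz≈Mz′ =
      ∙-cancelˡ (x ⁻¹) z z′ (injective (∙-cancelˡ x _ _ Mz≈Mz′))

    -- δ(x⁻¹) = σ_k(x⁻¹), the form in which δ(x) enters the intertwining identity.
    δx⁻¹ : δ (x ⁻¹) ≈ σ G k (x ⁻¹)
    δx⁻¹ = trans (⁻¹-homo x) (trans (⁻¹-cong δx) (conj-⁻¹ k x))

    twist : ∀ g h → σ G x (φ g ⁻¹) ∙ φ h ≈ M (σ G x (g ⁻¹) ∙ h)
    twist g h = begin
      x ∙ (k ⁻¹ ∙ δ g) ⁻¹ ∙ x ⁻¹ ∙ (k ⁻¹ ∙ δ h)
        ≈⟨ ∙-congʳ (∙-congʳ (∙-congˡ φg⁻¹)) ⟩
      x ∙ (δ g ⁻¹ ∙ k) ∙ x ⁻¹ ∙ (k ⁻¹ ∙ δ h)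
        ≈⟨ solve 6 (λ X A K Y L B → ((X ⊕ (A ⊕ K)) ⊕ Y) ⊕ (L ⊕ B)
                                    ⊜ X ⊕ ((A ⊕ ((K ⊕ Y) ⊕ L)) ⊕ B))
                   refl x (δ g ⁻¹) k (x ⁻¹) (k ⁻¹) (δ h) ⟩
      x ∙ (δ g ⁻¹ ∙ σ G k (x ⁻¹) ∙ δ h)
        ≈⟨ ∙-congˡ (∙-congʳ (∙-cong (sym (⁻¹-homo g)) (sym δx⁻¹))) ⟩
      x ∙ (δ (g ⁻¹) ∙ δ (x ⁻¹) ∙ δ h)
        ≈⟨ ∙-congˡ (sym (trans (∙-homo _ h) (∙-congʳ (∙-homo (g ⁻¹) (x ⁻¹))))) ⟩
      x ∙ δ (g ⁻¹ ∙ x ⁻¹ ∙ h)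
        ≈⟨ ∙-congˡ (⟦⟧-cong regroup) ⟩
      x ∙ δ (x ⁻¹ ∙ (x ∙ g ⁻¹ ∙ x ⁻¹ ∙ h)) ∎
      where
      φg⁻¹ : (k ⁻¹ ∙ δ g) ⁻¹ ≈ δ g ⁻¹ ∙ k
      φg⁻¹ = trans (⁻¹-anti-homo-∙ (k ⁻¹) (δ g)) (∙-congˡ (⁻¹-involutive k))

      regroup : g ⁻¹ ∙ x ⁻¹ ∙ h ≈ x ⁻¹ ∙ (x ∙ g ⁻¹ ∙ x ⁻¹ ∙ h)
      regroup = begin
        g ⁻¹ ∙ x ⁻¹ ∙ h                  ≈⟨ sym (\\-leftDividesʳ x _) ⟩
        x ⁻¹ ∙ (x ∙ (g ⁻¹ ∙ x ⁻¹ ∙ h))   ≈⟨ ∙-congˡ (solve 4 (λ X A Y H → X ⊕ ((A ⊕ Y) ⊕ H)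
                                                              ⊜ ((X ⊕ A) ⊕ Y) ⊕ H)
                                                          refl x (g ⁻¹) (x ⁻¹) h) ⟩
        x ⁻¹ ∙ (x ∙ g ⁻¹ ∙ x ⁻¹ ∙ h)     ∎

    module Endpoints (x⁻¹≈x : x ⁻¹ ≈ x) {a₁ a₂ : Carrier} (δxa₁ : δ (x ∙ a₁) ≈ x ∙ a₂) where
      M-a : M a₁ ≈ a₂
      M-a = begin
        x ∙ δ (x ⁻¹ ∙ a₁) ≈⟨ ∙-congˡ (⟦⟧-cong (∙-congʳ x⁻¹≈x)) ⟩
        x ∙ δ (x ∙ a₁)    ≈⟨ ∙-congˡ δxa₁ ⟩
        x ∙ (x ∙ a₂)      ≈⟨ ∙-congˡ (∙-congʳ (sym x⁻¹≈x)) ⟩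
        x ∙ (x ⁻¹ ∙ a₂)   ≈⟨ \\-leftDividesˡ x a₂ ⟩
        a₂                ∎

      M-α-a⁻¹ : M (σ G x (a₁ ⁻¹)) ≈ σ G x (a₂ ⁻¹)
      M-α-a⁻¹ = begin
        x ∙ δ (x ⁻¹ ∙ (x ∙ a₁ ⁻¹ ∙ x ⁻¹)) ≈⟨ ∙-congˡ (⟦⟧-cong (∙-congˡ (assoc x (a₁ ⁻¹) (x ⁻¹)))) ⟩
        x ∙ δ (x ⁻¹ ∙ (x ∙ (a₁ ⁻¹ ∙ x ⁻¹))) ≈⟨ ∙-congˡ (⟦⟧-cong (\\-leftDividesʳ x _)) ⟩
        x ∙ δ (a₁ ⁻¹ ∙ x ⁻¹)               ≈⟨ ∙-congˡ (⟦⟧-cong (sym (⁻¹-anti-homo-∙ x a₁))) ⟩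
        x ∙ δ ((x ∙ a₁) ⁻¹)                ≈⟨ ∙-congˡ (trans (⁻¹-homo _) (⁻¹-cong δxa₁)) ⟩
        x ∙ (x ∙ a₂) ⁻¹                    ≈⟨ ∙-congˡ (⁻¹-anti-homo-∙ x a₂) ⟩
        x ∙ (a₂ ⁻¹ ∙ x ⁻¹)                 ≈⟨ sym (assoc x (a₂ ⁻¹) (x ⁻¹)) ⟩
        x ∙ a₂ ⁻¹ ∙ x ⁻¹                   ∎

  Pair-resp : ∀ α a {y y′} → y ≈ y′ → Pair G α a y → Pair G α a y′
  Pair-resp α a y≈y′ (inj₁ y≈a)    = inj₁ (trans (sym y≈y′) y≈a)
  Pair-resp α a y≈y′ (inj₂ y≈αa⁻¹) = inj₂ (trans (sym y≈y′) y≈αa⁻¹)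

  Pair-transport : ∀ α (M : Carrier → Carrier) {a₁ a₂} →
                   (∀ {z z′} → z ≈ z′ → M z ≈ M z′) →
                   (∀ {z z′} → M z ≈ M z′ → z ≈ z′) →
                   M a₁ ≈ a₂ → M (α (a₁ ⁻¹)) ≈ α (a₂ ⁻¹) →
                   ∀ z → Pair G α a₁ z ⇔ Pair G α a₂ (M z)
  Pair-transport α M M-cong M-inj Ma Mb z = mk⇔ to from
    where
    to : Pair G α _ z → Pair G α _ (M z)
    to (inj₁ z≈a₁) = inj₁ (trans (M-cong z≈a₁) Ma)
    to (inj₂ z≈b₁) = inj₂ (trans (M-cong z≈b₁) Mb)

    from : Pair G α _ (M z) → Pair G α _ z
    from (inj₁ Mz≈a₂) = inj₁ (M-inj (trans Mz≈a₂ (sym Ma)))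
    from (inj₂ Mz≈b₂) = inj₂ (M-inj (trans Mz≈b₂ (sym Mb)))

  GC-iso : ∀ α (S₁ S₂ : Carrier → Set ℓ) (φ : Bijection setoid setoid) (M : Carrier → Carrier) →
           (∀ {y y′} → y ≈ y′ → S₂ y → S₂ y′) →
           (∀ z → S₁ z ⇔ S₂ (M z)) →
           (∀ g h → α (Bijection.to φ g ⁻¹) ∙ Bijection.to φ h ≈ M (α (g ⁻¹) ∙ h)) →
           GraphIso G (GCAdj G α S₁) (GCAdj G α S₂)
  GC-iso α S₁ S₂ φ M S₂-resp S₁⇔MS₂ intertwine = φ , λ g h →
      (λ adj₁ → S₂-resp (sym (intertwine g h)) (Equivalence.to (S₁⇔MS₂ _) adj₁))
    , (λ adj₂ → Equivalence.from (S₁⇔MS₂ _) (S₂-resp (intertwine g h) adj₂))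

corollary2p9 : {c ℓ : Level} (G : Group c ℓ) → IsFiniteGroup G → IsNonabelian G → IsSimple G →
    (x : Group.Carrier G) → IsInvolution G x →
    (a₁ a₂ : Group.Carrier G) →
    IsGenCayleySubset G (σ G x) (Pair G (σ G x) a₁) →
    IsGenCayleySubset G (σ G x) (Pair G (σ G x) a₂) →
    (∃[ δ ] (InΔ G (σ G x) δ × Group._≈_ G (δ (Group._∙_ G x a₁)) (Group._∙_ G x a₂))) →
    GraphIso G (GCAdj G (σ G x) (Pair G (σ G x) a₁)) (GCAdj G (σ G x) (Pair G (σ G x) a₂))
corollary2p9 G _ nonabelian simple x (_ , x²≈ε) a₁ a₂ _ _ (δ , δ∈Δ , δxa₁≈xa₂) =
  GC-iso G α (Pair G α a₁) (Pair G α a₂) φ-bijection M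
    (Pair-resp G α a₂)
    (Pair-transport G α M M-cong M-injective M-a M-α-a⁻¹)
    twist
  where
  open Group G using (sym)
  open import Algebra.Properties.Group G using (inverseʳ-unique)

  α = σ G x

  conjugator = Δ-conjugates G (centre-trivial G nonabelian simple) δ∈Δ

  open TwistedTranslation G x (proj₁ δ∈Δ) (proj₁ conjugator) (proj₂ conjugator)
  open Endpoints (sym (inverseʳ-unique x x x²≈ε)) δxa₁≈xa₂
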